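{- Let $p$ be a prime and $F\colon\mathbb F_p^n\to\mathbb F_p^m$ a function. If $$\mathcal N_F<\frac{p^{2(n-m)}}{1-\frac1{p^m}},$$ then $F$ is surjective.
   Context: Standard scalar product $\langle x,y\rangle=\sum_ix_iy_i$, $\zeta_p=e^{2\pi i/p}$, $W_F(b,a)=\sum_{x\in\mathbb F_p^n}\zeta_p^{\langle b,F(x)\rangle-\langle a,x\rangle}$, and the imbalance $\mathcal N_F=\frac1{p^m}\sum_{b\in\mathbb F_p^m\setminus\{0\}}|W_F(b,0)|^2$. -}

module Defs where

open import Data.Nat as ℕ using (ℕ; zero; suc; NonZero)
open import Data.Nat.DivMod using (_mod_)
open import Data.Fin as Fin using (Fin; toℕ)
open import Data.Fin.Properties using () renaming (_≟_ to _≟ᶠ_)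
open import Data.Vec as Vec using (Vec; []; _∷_; replicate; zipWith)
open import Data.Vec.Properties using (≡-dec)
open import Data.Integer as ℤ using (ℤ; +_; _-_)
open import Data.Rational as ℚ using (ℚ)
open import Data.Product using (∃-syntax; _×_)
open import Data.Bool using (if_then_else_)
open import Relation.Nullary using (does)
open import Relation.Binary.PropositionalEquality using (_≡_)

module _ (p : ℕ) .{{_ : NonZero p}} where

  Fp : Set
  Fp = Fin p

  Fpⁿ : ℕ → Set
  Fpⁿ n = Vec Fp n

  0ₚ : Fp
  0ₚ = 0 mod p

  _+ₚ_ : Fp → Fp → Fp
  a +ₚ b = (toℕ a ℕ.+ toℕ b) mod p

  _*ₚ_ : Fp → Fp → Fp
  a *ₚ b = (toℕ a ℕ.* toℕ b) mod p

  -ₚ_ : Fp → Fp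
  -ₚ a = (p ℕ.∸ toℕ a) mod p

  _-ₚ_ : Fp → Fp → Fp
  a -ₚ b = a +ₚ (-ₚ b)

  ⟨_,_⟩ : ∀ {n} → Fpⁿ n → Fpⁿ n → Fp
  ⟨ x , y ⟩ = Vec.foldr _ _+ₚ_ 0ₚ (zipWith _*ₚ_ x y)

  zeroVec : ∀ n → Fpⁿ n
  zeroVec n = replicate n 0ₚ

  ΣFin : ∀ {A : Set} → (A → A → A) → A → (k : ℕ) → (Fin k → A) → A
  ΣFin _⊕_ e zero    f = e
  ΣFin _⊕_ e (suc k) f = f Fin.zero ⊕ ΣFin _⊕_ e k (λ i → f (Fin.suc i))

  ΣVec : ∀ {A : Set} → (A → A → A) → A → (n : ℕ) → (Fpⁿ n → A) → A
  ΣVec _⊕_ e zero    f = f []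
  ΣVec _⊕_ e (suc n) f = ΣFin _⊕_ e p (λ c → ΣVec _⊕_ e n (λ v → f (c ∷ v)))

  -- The cyclotomic ring Z[ζ_p] = Z[C_p]/(1 + ζ + … + ζ^{p-1}).
  -- An element Σ_k u_k ζ^k is a coefficient function u : Fin p → ℤ;
  -- two such represent the same complex number iff their difference
  -- is a constant vector (p prime, Φ_p the minimal polynomial of ζ_p).
  Cyc : Set
  Cyc = Fp → ℤ

  _≈ᶜ_ : Cyc → Cyc → Set
  u ≈ᶜ v = ∃[ c ] ∀ k → u k - v k ≡ c

  0ᶜ : Cyc
  0ᶜ _ = + 0

  _+ᶜ_ : Cyc → Cyc → Cyc
  (u +ᶜ v) k = u k ℤ.+ v k

  ζ^ : Fp → Cyc
  ζ^ j k = if does (j ≟ᶠ k) then + 1 else + 0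

  ι : ℤ → Cyc
  ι r k = if does (0ₚ ≟ᶠ k) then r else + 0

  _*ᶜ_ : Cyc → Cyc → Cyc
  (u *ᶜ v) k = ΣFin ℤ._+_ (+ 0) p (λ i → u i ℤ.* v (k -ₚ i))

  conj : Cyc → Cyc
  conj u k = u (-ₚ k)

  ∣_∣² : Cyc → Cyc
  ∣ w ∣² = w *ᶜ conj w

  W : ∀ {n m} → (Fpⁿ n → Fpⁿ m) → Fpⁿ m → Fpⁿ n → Cyc
  W {n} F b a = ΣVec _+ᶜ_ 0ᶜ n (λ x → ζ^ (⟨ b , F x ⟩ -ₚ ⟨ a , x ⟩))

  imbalanceSum : ∀ {n m} → (Fpⁿ n → Fpⁿ m) → Cyc
  imbalanceSum {n} {m} F =
    ΣVec _+ᶜ_ 0ᶜ m (λ b → if does (≡-dec _≟ᶠ_ b (zeroVec m))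
                              then 0ᶜ
                              else ∣ W F b (zeroVec n) ∣²)

  -- "N_F = q": the imbalance N_F = p^{-m} Σ_{b≠0} |W_F(b,0)|² equals q ∈ ℚ,
  -- i.e. the sum is the rational integer r (in Z[ζ_p]) and q = r / p^m.
  ImbalanceIs : ∀ {n m} → (Fpⁿ n → Fpⁿ m) → ℚ → Set
  ImbalanceIs {n} {m} F q =
    ∃[ r ] (imbalanceSum F ≈ᶜ ι r) ×
           (q ≡ (r ℚ./ (p ℕ.^ m)) {{Data.Nat.Properties.m^n≢0 p m}})
    where import Data.Nat.Properties

Surjective : ∀ {A B : Set} → (A → B) → Set
Surjective {A} f = ∀ y → ∃[ x ] f x ≡ y

-- The field trace Tr of ℚ(ζ_p)/ℚ turns the hypothesis Σ_{b≠0} |W_F(b,0)|² = r into an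
-- identity between integers. Expanding |W_F(b,0)|² and summing over b with the orthogonality of the
-- characters b ↦ ζ_p^⟨b,u⟩ gives r = p^m·C − p^{2n}, where C = Σ_y N_y² counts the pairs (x, x′) with
-- F x = F x′ and N_y = |F⁻¹(y)|. If F misses a value y₀, the p^n points are distributed over at most
-- p^m − 1 fibres, so Cauchy–Schwarz gives (p^m − 1)·C ≥ p^{2n}, that is r·(p^m − 1) ≥ p^{2n}, which is
-- exactly the negation of N_F·(1 − p^{−m}) < p^{2(n−m)}.

module Submission where

open import Level using (0ℓ)
open import Algebra.Bundles using (CommutativeRing)
open import Algebra.Structures using (IsCommutativeRing)
open import Algebra.Consequences.Propositional
  using (comm∧idˡ⇒idʳ; comm∧invˡ⇒invʳ; comm∧distrʳ⇒distrˡ; comm∧assoc⇒middleFour)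
import Algebra.Properties.AbelianGroup as AbelianGroupProperties
import Algebra.Properties.Ring as RingProperties
open import Data.Bool using (true; false; if_then_else_)
open import Data.Bool.Properties using (if-float)
open import Data.Empty using (⊥-elim)
open import Data.Fin as Fin using (Fin; toℕ)
open import Data.Fin.Permutation using (permutation)
open import Data.Fin.Properties using (toℕ-injective; toℕ<n; toℕ-fromℕ<; any?) renaming (_≟_ to _≟ᶠ_)
open import Data.Integer as ℤ using (ℤ; +_; 0ℤ; 1ℤ; -1ℤ)
import Data.Integer.Properties as ℤ
open import Data.Integer.Tactic.RingSolver using (solve-∀)
open import Algebra.Properties.Semiring.Sum ℤ.+-*-semiring
  using (sum; sum-syntax; sum-cong-≗; ∑-comm; ∑-distrib-+; *-distribˡ-sum; *-distribʳ-sum; sum-permute)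
open import Data.Nat as ℕ using (ℕ; zero; suc; NonZero)
import Data.Nat.Properties as ℕ
open import Data.Nat.Coprimality using (prime⇒coprime; coprime-Bézout)
open import Data.Nat.DivMod
  using (_mod_; m%n<n; m<n⇒m%n≡m; n%n≡0; %-distribˡ-+; %-distribˡ-*; [m+kn]%n≡m%n; m*n%n≡0)
open import Data.Nat.GCD using (module Bézout)
open import Data.Nat.Primality using (Prime; prime⇒nonTrivial)
open import Data.Product using (∃; _,_; proj₁; proj₂)
import Data.Rational as ℚ
import Data.Rational.Properties as ℚ
import Data.Rational.Unnormalised as ℚᵘ
import Data.Rational.Unnormalised.Properties as ℚᵘ
open import Data.Vec using (Vec; []; _∷_; zipWith)
open import Data.Vec.Properties using (∷-injectiveˡ; ∷-injectiveʳ; ≡-dec)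
open import Function.Base using (_∘_)
open import Function.Bundles using (_⇔_; mk⇔)
open import Relation.Binary.Definitions using (DecidableEquality)
open import Relation.Binary.PropositionalEquality
open import Relation.Binary.PropositionalEquality.Properties using (isEquivalence)
open import Relation.Nullary using (¬_; Dec; yes; no; does; contradiction)
open import Relation.Nullary.Decidable using (does-⇔; map′)

open import Defs

𝟙 : ∀ {a} {A : Set a} → Dec A → ℤ
𝟙 a? = if does a? then 1ℤ else 0ℤ

module _ {a b} {A : Set a} {B : Set b} where

  𝟙-⇔ : A ⇔ B → (a? : Dec A) (b? : Dec B) → 𝟙 a? ≡ 𝟙 b?
  𝟙-⇔ A⇔B a? b? = cong (if_then 1ℤ else 0ℤ) (does-⇔ A⇔B a? b?)

module _ {a} {A : Set a} where

  𝟙-yes : (a? : Dec A) → A → 𝟙 a? ≡ 1ℤ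
  𝟙-yes (yes _) _ = refl
  𝟙-yes (no ¬a) a = contradiction a ¬a

  𝟙-no : (a? : Dec A) → ¬ A → 𝟙 a? ≡ 0ℤ
  𝟙-no (yes a) ¬a = contradiction a ¬a
  𝟙-no (no _)  _  = refl

module _ {a} {A : Set a} (_≟_ : DecidableEquality A) where

  𝟙-sym : ∀ x y → 𝟙 (x ≟ y) ≡ 𝟙 (y ≟ x)
  𝟙-sym x y = 𝟙-⇔ (mk⇔ sym sym) (x ≟ y) (y ≟ x)

  𝟙-∷ : ∀ {n} x y (u v : Vec A n) → 𝟙 (≡-dec _≟_ (x ∷ u) (y ∷ v)) ≡ 𝟙 (x ≟ y) ℤ.* 𝟙 (≡-dec _≟_ u v)
  𝟙-∷ x y u v with x ≟ y | ≡-dec _≟_ u v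
  ... | yes refl | yes refl = refl
  ... | yes _    | no _     = refl
  ... | no _     | u≟v      = sym (ℤ.*-zeroˡ (𝟙 u≟v))

+q-1-positive : ∀ {q} → 1 ℕ.< q → ℤ.Positive (+ q ℤ.- 1ℤ)
+q-1-positive {suc (suc _)} _                   = _
+q-1-positive {suc zero}    (ℕ.s≤s ())

square-nonneg : ∀ i → 0ℤ ℤ.≤ i ℤ.* i
square-nonneg (+ k)      = subst (0ℤ ℤ.≤_) (ℤ.pos-* k k) (ℤ.+≤+ ℕ.z≤n)
square-nonneg ℤ.-[1+ k ] = ℤ.+≤+ ℕ.z≤n

toℚᵘ-/ : ∀ i a → ℚ.toℚᵘ (i ℚ./ suc a) ℚᵘ.≃ ℚᵘ.mkℚᵘ i a
toℚᵘ-/ i a with i ℚ./ suc a in eq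
... | q@(ℚ.mkℚ _ _ _) = ℚ./-injective-≃ (ℚᵘ.mkℚᵘ _ _) (ℚᵘ.mkℚᵘ i a) (trans (ℚ.↥p/↧p≡p q) (sym eq))

r/M*[1-1/M]<B/M²⇒r*[M-1]<B : ∀ M .{{_ : NonZero M}} M² .{{_ : NonZero M²}} → M² ≡ M ℕ.* M → ∀ (r B : ℤ) →
                             (r ℚ./ M) ℚ.* (ℚ.1ℚ ℚ.- (1ℤ ℚ./ M)) ℚ.< B ℚ./ M² → r ℤ.* (+ M ℤ.- 1ℤ) ℤ.< B
r/M*[1-1/M]<B/M²⇒r*[M-1]<B (suc a) .(suc a ℕ.* suc a) refl r B lhs<rhs =
  ℤ.*-cancelʳ-<-nonNeg (+ (suc a ℕ.* suc a))
    (subst₂ ℤ._<_ (cong (ℤ._* + (suc a ℕ.* suc a)) (simplify r (+ suc a)))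
                  (cong (λ d → B ℤ.* + (suc a ℕ.* d)) (ℕ.*-identityˡ (suc a)))
                  cleared)
  where
  simplify : ∀ r s → r ℤ.* (1ℤ ℤ.* s ℤ.+ ℤ.- 1ℤ ℤ.* 1ℤ) ≡ r ℤ.* (s ℤ.- 1ℤ)
  simplify = solve-∀
  lhs≃ : ℚ.toℚᵘ ((r ℚ./ suc a) ℚ.* (ℚ.1ℚ ℚ.- (1ℤ ℚ./ suc a))) ℚᵘ.≃ ℚᵘ.mkℚᵘ r a ℚᵘ.* (ℚᵘ.1ℚᵘ ℚᵘ.- ℚᵘ.mkℚᵘ 1ℤ a)
  lhs≃ = ℚᵘ.≃-trans (ℚ.toℚᵘ-homo-* (r ℚ./ suc a) (ℚ.1ℚ ℚ.- (1ℤ ℚ./ suc a)))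
           (ℚᵘ.*-cong (toℚᵘ-/ r a) (ℚᵘ.≃-trans (ℚ.toℚᵘ-homo-+ ℚ.1ℚ (ℚ.- (1ℤ ℚ./ suc a)))
             (ℚᵘ.+-cong ℚᵘ.≃-refl (ℚᵘ.≃-trans (ℚ.toℚᵘ-homo‿- (1ℤ ℚ./ suc a)) (ℚᵘ.-‿cong (toℚᵘ-/ 1ℤ a))))))
  -- On unnormalised rationals _<_ is cross-multiplication, so the hypothesis becomes an integer inequality.
  cleared : r ℤ.* (1ℤ ℤ.* + suc a ℤ.+ ℤ.- 1ℤ ℤ.* 1ℤ) ℤ.* + (suc a ℕ.* suc a) ℤ.< B ℤ.* + (suc a ℕ.* (1 ℕ.* suc a))
  cleared with ℚᵘ.<-respʳ-≃ (toℚᵘ-/ B (a ℕ.+ a ℕ.* suc a)) (ℚᵘ.<-respˡ-≃ lhs≃ (ℚ.toℚᵘ-mono-< lhs<rhs))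
  ... | ℚᵘ.*<* ineq = ineq

^-double : ∀ q k → q ℕ.^ (2 ℕ.* k) ≡ q ℕ.^ k ℕ.* q ℕ.^ k
^-double q k = trans (ℕ.^-distribˡ-+-* q k (k ℕ.+ 0)) (cong (λ j → q ℕ.^ k ℕ.* q ℕ.^ j) (ℕ.+-identityʳ k))

any?ᵥ : ∀ {k} n {P : Vec (Fin k) n → Set} → (∀ x → Dec (P x)) → Dec (∃ P)
any?ᵥ zero    P? = map′ ([] ,_) (λ { ([] , P[]) → P[] }) (P? [])
any?ᵥ (suc n) P? = map′ (λ (c , v , Pcv) → c ∷ v , Pcv) (λ { (c ∷ v , Pcv) → c , v , Pcv })
                        (any? (λ c → any?ᵥ n (λ v → P? (c ∷ v))))

infix 4 _≟ᵥ_

_≟ᵥ_ : ∀ {k n} → DecidableEquality (Vec (Fin k) n)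
_≟ᵥ_ = ≡-dec _≟ᶠ_

module PrimeField (p : ℕ) .{{_ : NonZero p}} where

  infixl 6 _⊕_ _⊖_
  infixl 7 _⊗_
  infix 8 ⊝_

  _⊕_ _⊖_ _⊗_ : Fp p → Fp p → Fp p
  _⊕_ = _+ₚ_ p
  _⊖_ = _-ₚ_ p
  _⊗_ = _*ₚ_ p

  ⊝_ : Fp p → Fp p
  ⊝_ = -ₚ_ p

  0# 1# : Fp p
  0# = 0ₚ p
  1# = 1 mod p

  toℕ-mod : ∀ x → toℕ (x mod p) ≡ x ℕ.% p
  toℕ-mod x = toℕ-fromℕ< (m%n<n x p)

  mod-cong : ∀ {x y} → x ℕ.% p ≡ y ℕ.% p → x mod p ≡ y mod p
  mod-cong {x} {y} eq = toℕ-injective (trans (toℕ-mod x) (trans eq (sym (toℕ-mod y))))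

  toℕ-mod-inverse : ∀ a → toℕ a mod p ≡ a
  toℕ-mod-inverse a = toℕ-injective (trans (toℕ-mod (toℕ a)) (m<n⇒m%n≡m (toℕ<n a)))

  mod-+ : ∀ x y → (x mod p) ⊕ (y mod p) ≡ (x ℕ.+ y) mod p
  mod-+ x y = mod-cong (begin
    (toℕ (x mod p) ℕ.+ toℕ (y mod p)) ℕ.% p ≡⟨ cong₂ (λ u v → (u ℕ.+ v) ℕ.% p) (toℕ-mod x) (toℕ-mod y) ⟩
    (x ℕ.% p ℕ.+ y ℕ.% p) ℕ.% p             ≡⟨ %-distribˡ-+ x y p ⟨
    (x ℕ.+ y) ℕ.% p                         ∎)
    where open ≡-Reasoning

  mod-* : ∀ x y → (x mod p) ⊗ (y mod p) ≡ (x ℕ.* y) mod p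
  mod-* x y = mod-cong (begin
    (toℕ (x mod p) ℕ.* toℕ (y mod p)) ℕ.% p ≡⟨ cong₂ (λ u v → (u ℕ.* v) ℕ.% p) (toℕ-mod x) (toℕ-mod y) ⟩
    (x ℕ.% p ℕ.* (y ℕ.% p)) ℕ.% p           ≡⟨ %-distribˡ-* x y p ⟨
    (x ℕ.* y) ℕ.% p                         ∎)
    where open ≡-Reasoning

  0%p≡0 : 0 ℕ.% p ≡ 0
  0%p≡0 = m<n⇒m%n≡m (ℕ.>-nonZero⁻¹ p)

  -- Each law is transported from ℕ along the surjection _mod p.

  ⊝-inverseˡ : ∀ a → ⊝ a ⊕ a ≡ 0#
  ⊝-inverseˡ a = begin
    (p ℕ.∸ toℕ a) mod p ⊕ a                ≡⟨ cong ((p ℕ.∸ toℕ a) mod p ⊕_) (toℕ-mod-inverse a) ⟨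
    (p ℕ.∸ toℕ a) mod p ⊕ (toℕ a mod p)    ≡⟨ mod-+ _ _ ⟩
    (p ℕ.∸ toℕ a ℕ.+ toℕ a) mod p          ≡⟨ cong (_mod p) (ℕ.m∸n+n≡m (ℕ.<⇒≤ (toℕ<n a))) ⟩
    p mod p                                ≡⟨ mod-cong (trans (n%n≡0 p) (sym 0%p≡0)) ⟩
    0#                                     ∎
    where open ≡-Reasoning

  ⊕-assoc : ∀ a b c → (a ⊕ b) ⊕ c ≡ a ⊕ (b ⊕ c)
  ⊕-assoc a b c = begin
    (a ⊕ b) ⊕ c                              ≡⟨ cong ((a ⊕ b) ⊕_) (toℕ-mod-inverse c) ⟨
    (a ⊕ b) ⊕ (toℕ c mod p)                  ≡⟨ mod-+ _ _ ⟩
    (toℕ a ℕ.+ toℕ b ℕ.+ toℕ c) mod p        ≡⟨ cong (_mod p) (ℕ.+-assoc (toℕ a) _ _) ⟩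
    (toℕ a ℕ.+ (toℕ b ℕ.+ toℕ c)) mod p      ≡⟨ mod-+ _ _ ⟨
    (toℕ a mod p) ⊕ (b ⊕ c)                  ≡⟨ cong (_⊕ (b ⊕ c)) (toℕ-mod-inverse a) ⟩
    a ⊕ (b ⊕ c)                              ∎
    where open ≡-Reasoning

  ⊗-assoc : ∀ a b c → (a ⊗ b) ⊗ c ≡ a ⊗ (b ⊗ c)
  ⊗-assoc a b c = begin
    (a ⊗ b) ⊗ c                              ≡⟨ cong ((a ⊗ b) ⊗_) (toℕ-mod-inverse c) ⟨
    (a ⊗ b) ⊗ (toℕ c mod p)                  ≡⟨ mod-* _ _ ⟩
    (toℕ a ℕ.* toℕ b ℕ.* toℕ c) mod p        ≡⟨ cong (_mod p) (ℕ.*-assoc (toℕ a) _ _) ⟩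
    (toℕ a ℕ.* (toℕ b ℕ.* toℕ c)) mod p      ≡⟨ mod-* _ _ ⟨
    (toℕ a mod p) ⊗ (b ⊗ c)                  ≡⟨ cong (_⊗ (b ⊗ c)) (toℕ-mod-inverse a) ⟩
    a ⊗ (b ⊗ c)                              ∎
    where open ≡-Reasoning

  ⊗-distribʳ-⊕ : ∀ c a b → (a ⊕ b) ⊗ c ≡ a ⊗ c ⊕ b ⊗ c
  ⊗-distribʳ-⊕ c a b = begin
    (a ⊕ b) ⊗ c                                  ≡⟨ cong ((a ⊕ b) ⊗_) (toℕ-mod-inverse c) ⟨
    (a ⊕ b) ⊗ (toℕ c mod p)                      ≡⟨ mod-* _ _ ⟩
    ((toℕ a ℕ.+ toℕ b) ℕ.* toℕ c) mod p          ≡⟨ cong (_mod p) (ℕ.*-distribʳ-+ (toℕ c) (toℕ a) _) ⟩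
    (toℕ a ℕ.* toℕ c ℕ.+ toℕ b ℕ.* toℕ c) mod p  ≡⟨ mod-+ _ _ ⟨
    a ⊗ c ⊕ b ⊗ c                                ∎
    where open ≡-Reasoning

  ⊕-comm : ∀ a b → a ⊕ b ≡ b ⊕ a
  ⊕-comm a b = cong (_mod p) (ℕ.+-comm (toℕ a) (toℕ b))

  ⊗-comm : ∀ a b → a ⊗ b ≡ b ⊗ a
  ⊗-comm a b = cong (_mod p) (ℕ.*-comm (toℕ a) (toℕ b))

  mod-identityˡ : ∀ {e} {_∙_ : Fp p → Fp p → Fp p} {_∘_ : ℕ → ℕ → ℕ} →
                  (∀ x y → (x mod p) ∙ (y mod p) ≡ (x ∘ y) mod p) → (∀ x → e ∘ x ≡ x) →
                  ∀ a → (e mod p) ∙ a ≡ a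
  mod-identityˡ {e} {_∙_} {_∘_} homo identity a = begin
    (e mod p) ∙ a               ≡⟨ cong ((e mod p) ∙_) (toℕ-mod-inverse a) ⟨
    (e mod p) ∙ (toℕ a mod p)   ≡⟨ homo e (toℕ a) ⟩
    (e ∘ toℕ a) mod p           ≡⟨ cong (_mod p) (identity (toℕ a)) ⟩
    toℕ a mod p                 ≡⟨ toℕ-mod-inverse a ⟩
    a                           ∎
    where open ≡-Reasoning

  ⊕-⊗-isCommutativeRing : IsCommutativeRing _≡_ _⊕_ _⊗_ ⊝_ 0# 1#
  ⊕-⊗-isCommutativeRing = record
    { isRing = record
      { +-isAbelianGroup = record
        { isGroup = record
          { isMonoid = record
            { isSemigroup = record
              { isMagma = record { isEquivalence = isEquivalence ; ∙-cong = cong₂ _⊕_ }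
              ; assoc = ⊕-assoc
              }
            ; identity = ⊕-identityˡ , comm∧idˡ⇒idʳ ⊕-comm ⊕-identityˡ
            }
          ; inverse = ⊝-inverseˡ , comm∧invˡ⇒invʳ ⊕-comm ⊝-inverseˡ
          ; ⁻¹-cong = cong ⊝_
          }
        ; comm = ⊕-comm
        }
      ; *-cong = cong₂ _⊗_
      ; *-assoc = ⊗-assoc
      ; *-identity = ⊗-identityˡ , comm∧idˡ⇒idʳ ⊗-comm ⊗-identityˡ
      ; distrib = comm∧distrʳ⇒distrˡ ⊗-comm ⊗-distribʳ-⊕ , ⊗-distribʳ-⊕
      }
    ; *-comm = ⊗-comm
    }
    where
    ⊕-identityˡ : ∀ a → 0# ⊕ a ≡ a
    ⊕-identityˡ = mod-identityˡ {0} {_⊕_} {ℕ._+_} mod-+ (λ _ → refl)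
    ⊗-identityˡ : ∀ a → 1# ⊗ a ≡ a
    ⊗-identityˡ = mod-identityˡ {1} {_⊗_} {ℕ._*_} mod-* ℕ.*-identityˡ

  ⊕-⊗-commutativeRing : CommutativeRing 0ℓ 0ℓ
  ⊕-⊗-commutativeRing = record { isCommutativeRing = ⊕-⊗-isCommutativeRing }

  open CommutativeRing ⊕-⊗-commutativeRing public
    using (+-identityˡ; +-identityʳ; -‿inverseʳ; zeroˡ; zeroʳ; *-identityʳ; *-assoc; *-comm)
  open AbelianGroupProperties (CommutativeRing.+-abelianGroup ⊕-⊗-commutativeRing) public
    using (ε⁻¹≈ε; ⁻¹-involutive; x∙y⁻¹≈ε⇒x≈y; //-rightDividesˡ; //-rightDividesʳ;
           inverseˡ-unique; ⁻¹-anti-homo‿-; ⁻¹-∙-comm)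
  open RingProperties (CommutativeRing.ring ⊕-⊗-commutativeRing) public
    using (-‿distribʳ-*; x[y-z]≈xy-xz)

  ⊖-identityʳ : ∀ a → a ⊖ 0# ≡ a
  ⊖-identityʳ a = trans (cong (a ⊕_) ε⁻¹≈ε) (+-identityʳ a)

  ⊕-shift : ∀ x t k → x ⊕ t ≡ k → t ≡ k ⊖ x
  ⊕-shift x t k eq = begin
    t            ≡⟨ //-rightDividesʳ x t ⟨
    t ⊕ x ⊖ x    ≡⟨ cong (_⊖ x) (trans (⊕-comm t x) eq) ⟩
    k ⊖ x        ∎
    where open ≡-Reasoning

  ⊕-unshift : ∀ x t k → t ≡ k ⊖ x → x ⊕ t ≡ k
  ⊕-unshift x t k refl = trans (⊕-comm x (k ⊖ x)) (//-rightDividesˡ x k)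

  ⊗-inverse : Prime p → ∀ e → e ≢ 0# → ∃ λ e⁻¹ → e ⊗ e⁻¹ ≡ 1#
  ⊗-inverse p-prime e e≢0
    with coprime-Bézout (prime⇒coprime p-prime {{ℕ.≢-nonZero toℕe≢0}} (toℕ<n e))
    where
    toℕe≢0 : toℕ e ≢ 0
    toℕe≢0 eq = e≢0 (toℕ-injective (trans eq (sym (trans (toℕ-mod 0) 0%p≡0))))
  ... | Bézout.-+ x y eq = y mod p , (begin
    e ⊗ (y mod p)                 ≡⟨ ⊗-comm e _ ⟩
    (y mod p) ⊗ e                 ≡⟨ cong ((y mod p) ⊗_) (toℕ-mod-inverse e) ⟨
    (y mod p) ⊗ (toℕ e mod p)     ≡⟨ mod-* y (toℕ e) ⟩
    (y ℕ.* toℕ e) mod p           ≡⟨ cong (_mod p) eq ⟨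
    (1 ℕ.+ x ℕ.* p) mod p         ≡⟨ mod-cong ([m+kn]%n≡m%n 1 x p) ⟩
    1#                            ∎)
    where open ≡-Reasoning
  ... | Bézout.+- x y eq = ⊝ (y mod p) , (begin
    e ⊗ ⊝ (y mod p)               ≡⟨ -‿distribʳ-* e (y mod p) ⟨
    ⊝ (e ⊗ (y mod p))             ≡⟨ cong ⊝_ (trans (⊗-comm e _) (inverseˡ-unique _ _ y⊗e⊕1≡0)) ⟩
    ⊝ ⊝ 1#                        ≡⟨ ⁻¹-involutive 1# ⟩
    1#                            ∎)
    where
    open ≡-Reasoning
    y⊗e⊕1≡0 : (y mod p) ⊗ e ⊕ 1# ≡ 0#
    y⊗e⊕1≡0 = begin
      (y mod p) ⊗ e ⊕ 1#                        ≡⟨ cong (λ a → (y mod p) ⊗ a ⊕ 1#) (toℕ-mod-inverse e) ⟨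
      (y mod p) ⊗ (toℕ e mod p) ⊕ 1#            ≡⟨ cong (_⊕ 1#) (mod-* y (toℕ e)) ⟩
      (y ℕ.* toℕ e) mod p ⊕ (1 mod p)           ≡⟨ mod-+ _ 1 ⟩
      (y ℕ.* toℕ e ℕ.+ 1) mod p                 ≡⟨ cong (_mod p) (trans (ℕ.+-comm _ 1) eq) ⟩
      (x ℕ.* p) mod p                           ≡⟨ mod-cong (trans (m*n%n≡0 x p) (sym 0%p≡0)) ⟩
      0#                                        ∎

  ⊗-scale : ∀ {e e⁻¹} → e ⊗ e⁻¹ ≡ 1# → ∀ c k → c ⊗ e ≡ k → c ≡ k ⊗ e⁻¹
  ⊗-scale {e} {e⁻¹} inv c k refl = sym (begin
    c ⊗ e ⊗ e⁻¹     ≡⟨ *-assoc c e e⁻¹ ⟩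
    c ⊗ (e ⊗ e⁻¹)   ≡⟨ cong (c ⊗_) inv ⟩
    c ⊗ 1#          ≡⟨ *-identityʳ c ⟩
    c               ∎)
    where open ≡-Reasoning

  ⊗-unscale : ∀ {e e⁻¹} → e ⊗ e⁻¹ ≡ 1# → ∀ c k → c ≡ k ⊗ e⁻¹ → c ⊗ e ≡ k
  ⊗-unscale {e} {e⁻¹} inv c k refl = begin
    k ⊗ e⁻¹ ⊗ e     ≡⟨ *-assoc k e⁻¹ e ⟩
    k ⊗ (e⁻¹ ⊗ e)   ≡⟨ cong (k ⊗_) (trans (*-comm e⁻¹ e) inv) ⟩
    k ⊗ 1#          ≡⟨ *-identityʳ k ⟩
    k               ∎
    where open ≡-Reasoning

  infixl 7 _·_
  infixl 6 _⊖ᵥ_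

  _·_ : ∀ {n} → Fpⁿ p n → Fpⁿ p n → Fp p
  _·_ = ⟨_,_⟩ p

  _⊖ᵥ_ : ∀ {n} → Fpⁿ p n → Fpⁿ p n → Fpⁿ p n
  _⊖ᵥ_ = zipWith _⊖_

  ·-zeroˡ : ∀ {n} (x : Fpⁿ p n) → zeroVec p n · x ≡ 0#
  ·-zeroˡ []      = refl
  ·-zeroˡ (a ∷ x) = trans (cong₂ _⊕_ (zeroˡ a) (·-zeroˡ x)) (+-identityˡ 0#)

  ·-zeroʳ : ∀ {n} (b : Fpⁿ p n) → b · zeroVec p n ≡ 0#
  ·-zeroʳ []      = refl
  ·-zeroʳ (c ∷ b) = trans (cong₂ _⊕_ (zeroʳ c) (·-zeroʳ b)) (+-identityˡ 0#)

  ·-distribˡ-⊖ᵥ : ∀ {n} (b u v : Fpⁿ p n) → b · (u ⊖ᵥ v) ≡ b · u ⊖ b · v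
  ·-distribˡ-⊖ᵥ []      []      []       = sym (⊖-identityʳ 0#)
  ·-distribˡ-⊖ᵥ (c ∷ b) (a ∷ u) (a′ ∷ v) = begin
    c ⊗ (a ⊖ a′) ⊕ b · (u ⊖ᵥ v)               ≡⟨ cong₂ _⊕_ (x[y-z]≈xy-xz c a a′) (·-distribˡ-⊖ᵥ b u v) ⟩
    (c ⊗ a ⊖ c ⊗ a′) ⊕ (b · u ⊖ b · v)        ≡⟨ comm∧assoc⇒middleFour ⊕-comm ⊕-assoc (c ⊗ a) (⊝ (c ⊗ a′)) (b · u) (⊝ (b · v)) ⟩
    (c ⊗ a ⊕ b · u) ⊕ (⊝ (c ⊗ a′) ⊕ ⊝ (b · v)) ≡⟨ cong (c ⊗ a ⊕ b · u ⊕_) (⁻¹-∙-comm (c ⊗ a′) (b · v)) ⟩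
    (c ⊗ a ⊕ b · u) ⊖ (c ⊗ a′ ⊕ b · v)        ∎
    where open ≡-Reasoning

  ⊖ᵥ≡0⇒≡ : ∀ {n} (u v : Fpⁿ p n) → u ⊖ᵥ v ≡ zeroVec p n → u ≡ v
  ⊖ᵥ≡0⇒≡ []      []      _  = refl
  ⊖ᵥ≡0⇒≡ (a ∷ u) (b ∷ v) eq = cong₂ _∷_ (x∙y⁻¹≈ε⇒x≈y a b (∷-injectiveˡ eq)) (⊖ᵥ≡0⇒≡ u v (∷-injectiveʳ eq))


module FinSums where

  open import Data.Integer using (_+_; _*_; _≤_)

  sum-const : ∀ k c → ∑[ i < k ] c ≡ + k * c
  sum-const zero    c = sym (ℤ.*-zeroˡ c)
  sum-const (suc k) c = begin
    c + ∑[ i < k ] c      ≡⟨ cong (_+_ c) (sum-const k c) ⟩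
    c + + k * c           ≡⟨ cong (_+ + k * c) (ℤ.*-identityˡ c) ⟨
    1ℤ * c + + k * c      ≡⟨ ℤ.*-distribʳ-+ c 1ℤ (+ k) ⟨
    + suc k * c           ∎
    where open ≡-Reasoning

  sum-nonneg : ∀ {k} (f : Fin k → ℤ) → (∀ i → 0ℤ ≤ f i) → 0ℤ ≤ sum f
  sum-nonneg {zero}  f f≥0 = ℤ.≤-refl
  sum-nonneg {suc k} f f≥0 = ℤ.+-mono-≤ (f≥0 Fin.zero) (sum-nonneg (f ∘ Fin.suc) (f≥0 ∘ Fin.suc))

  sum-zero : ∀ k → ∑[ i < k ] 0ℤ ≡ 0ℤ
  sum-zero k = trans (sum-const k 0ℤ) (ℤ.*-zeroʳ (+ k))

  sum-𝟙 : ∀ {k} (a : Fin k) (g : Fin k → ℤ) → ∑[ i < k ] (𝟙 (a ≟ᶠ i) * g i) ≡ g a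
  sum-𝟙 {suc k} Fin.zero g = begin
    1ℤ * g Fin.zero + ∑[ i < k ] (0ℤ * g (Fin.suc i))  ≡⟨ cong₂ _+_ (ℤ.*-identityˡ (g Fin.zero)) (sum-cong-≗ (ℤ.*-zeroˡ ∘ g ∘ Fin.suc)) ⟩
    g Fin.zero + ∑[ i < k ] 0ℤ                         ≡⟨ cong (_+_ (g Fin.zero)) (sum-zero k) ⟩
    g Fin.zero + 0ℤ                                    ≡⟨ ℤ.+-identityʳ _ ⟩
    g Fin.zero                                         ∎
    where open ≡-Reasoning
  sum-𝟙 {suc k} (Fin.suc a) g = trans (ℤ.+-identityˡ _) (sum-𝟙 a (g ∘ Fin.suc))

module VecSums (p : ℕ) .{{_ : NonZero p}} where

  open import Data.Integer using (_+_; _*_; _-_; -_; _≤_)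
  open FinSums

  pᵢ^ : ℕ → ℤ
  pᵢ^ n = + (p ℕ.^ n)

  p*pᵢ^ : ∀ n → + p * pᵢ^ n ≡ pᵢ^ (suc n)
  p*pᵢ^ n = sym (ℤ.pos-* p (p ℕ.^ n))

  Σᵥ : ∀ n → (Fpⁿ p n → ℤ) → ℤ
  Σᵥ zero    f = f []
  Σᵥ (suc n) f = ∑[ c < p ] Σᵥ n (λ v → f (c ∷ v))

  Σᵥ-cong : ∀ n {f g : Fpⁿ p n → ℤ} → (∀ x → f x ≡ g x) → Σᵥ n f ≡ Σᵥ n g
  Σᵥ-cong zero    f≗g = f≗g []
  Σᵥ-cong (suc n) f≗g = sum-cong-≗ (λ c → Σᵥ-cong n (λ v → f≗g (c ∷ v)))

  Σᵥ-distrib-+ : ∀ n (f g : Fpⁿ p n → ℤ) → Σᵥ n (λ x → f x + g x) ≡ Σᵥ n f + Σᵥ n g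
  Σᵥ-distrib-+ zero    f g = refl
  Σᵥ-distrib-+ (suc n) f g =
    trans (sum-cong-≗ (λ c → Σᵥ-distrib-+ n (λ v → f (c ∷ v)) (λ v → g (c ∷ v))))
          (∑-distrib-+ (λ c → Σᵥ n (λ v → f (c ∷ v))) (λ c → Σᵥ n (λ v → g (c ∷ v))))

  *-distribˡ-Σᵥ : ∀ n c (f : Fpⁿ p n → ℤ) → c * Σᵥ n f ≡ Σᵥ n (λ x → c * f x)
  *-distribˡ-Σᵥ zero    c f = refl
  *-distribˡ-Σᵥ (suc n) c f = trans (*-distribˡ-sum c (λ c′ → Σᵥ n (λ v → f (c′ ∷ v)))) (sum-cong-≗ (λ c′ → *-distribˡ-Σᵥ n c (λ v → f (c′ ∷ v))))

  Σᵥ-distrib-sub : ∀ n (f g : Fpⁿ p n → ℤ) → Σᵥ n (λ x → f x - g x) ≡ Σᵥ n f - Σᵥ n g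
  Σᵥ-distrib-sub n f g = begin
    Σᵥ n (λ x → f x - g x)                ≡⟨ Σᵥ-cong n (λ x → cong (_+_ (f x)) (ℤ.-1*i≡-i (g x))) ⟨
    Σᵥ n (λ x → f x + -1ℤ * g x)          ≡⟨ Σᵥ-distrib-+ n f _ ⟩
    Σᵥ n f + Σᵥ n (λ x → -1ℤ * g x)       ≡⟨ cong (_+_ (Σᵥ n f)) (*-distribˡ-Σᵥ n -1ℤ g) ⟨
    Σᵥ n f + -1ℤ * Σᵥ n g                 ≡⟨ cong (_+_ (Σᵥ n f)) (ℤ.-1*i≡-i (Σᵥ n g)) ⟩
    Σᵥ n f - Σᵥ n g                       ∎
    where open ≡-Reasoning

  Σᵥ-const : ∀ n c → Σᵥ n (λ _ → c) ≡ pᵢ^ n * c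
  Σᵥ-const zero    c = sym (ℤ.*-identityˡ c)
  Σᵥ-const (suc n) c = begin
    ∑[ i < p ] Σᵥ n (λ _ → c)       ≡⟨ sum-cong-≗ {p} (λ _ → Σᵥ-const n c) ⟩
    ∑[ i < p ] (+ (p ℕ.^ n) * c)    ≡⟨ sum-const p _ ⟩
    + p * (+ (p ℕ.^ n) * c)         ≡⟨ ℤ.*-assoc (+ p) (+ (p ℕ.^ n)) c ⟨
    + p * + (p ℕ.^ n) * c           ≡⟨ cong (_* c) (p*pᵢ^ n) ⟩
    + (p ℕ.^ suc n) * c             ∎
    where open ≡-Reasoning

  Σᵥ-affine : ∀ n a c (f : Fpⁿ p n → ℤ) → Σᵥ n (λ x → a * f x - c) ≡ a * Σᵥ n f - pᵢ^ n * c
  Σᵥ-affine n a c f = trans (Σᵥ-distrib-sub n (λ x → a * f x) (λ _ → c))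
                            (cong₂ _-_ (sym (*-distribˡ-Σᵥ n a f)) (Σᵥ-const n c))

  Σᵥ-nonneg : ∀ n (f : Fpⁿ p n → ℤ) → (∀ x → 0ℤ ≤ f x) → 0ℤ ≤ Σᵥ n f
  Σᵥ-nonneg zero    f f≥0 = f≥0 []
  Σᵥ-nonneg (suc n) f f≥0 = sum-nonneg _ (λ c → Σᵥ-nonneg n _ (λ v → f≥0 (c ∷ v)))

  Σᵥ-comm-sum : ∀ n {k} (f : Fpⁿ p n → Fin k → ℤ) →
                Σᵥ n (λ x → ∑[ i < k ] f x i) ≡ ∑[ i < k ] Σᵥ n (λ x → f x i)
  Σᵥ-comm-sum zero    f = refl
  Σᵥ-comm-sum (suc n) f =
    trans (sum-cong-≗ (λ c → Σᵥ-comm-sum n (λ v → f (c ∷ v)))) (∑-comm (λ c i → Σᵥ n (λ v → f (c ∷ v) i)))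

  Σᵥ-comm : ∀ n m (f : Fpⁿ p n → Fpⁿ p m → ℤ) →
            Σᵥ n (λ x → Σᵥ m (λ y → f x y)) ≡ Σᵥ m (λ y → Σᵥ n (λ x → f x y))
  Σᵥ-comm zero    m f = refl
  Σᵥ-comm (suc n) m f =
    trans (sum-cong-≗ (λ c → Σᵥ-comm n m (λ v → f (c ∷ v)))) (sym (Σᵥ-comm-sum m (λ y c → Σᵥ n (λ v → f (c ∷ v) y))))

  Σᵥ-*-Σᵥ : ∀ n (f g : Fpⁿ p n → ℤ) → Σᵥ n f * Σᵥ n g ≡ Σᵥ n (λ x → Σᵥ n (λ x′ → f x * g x′))
  Σᵥ-*-Σᵥ n f g = begin
    Σᵥ n f * Σᵥ n g                       ≡⟨ ℤ.*-comm (Σᵥ n f) _ ⟩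
    Σᵥ n g * Σᵥ n f                       ≡⟨ *-distribˡ-Σᵥ n (Σᵥ n g) f ⟩
    Σᵥ n (λ x → Σᵥ n g * f x)             ≡⟨ Σᵥ-cong n (λ x → trans (ℤ.*-comm (Σᵥ n g) (f x)) (*-distribˡ-Σᵥ n (f x) g)) ⟩
    Σᵥ n (λ x → Σᵥ n (λ x′ → f x * g x′)) ∎
    where open ≡-Reasoning

  Σᵥ-𝟙 : ∀ n (a : Fpⁿ p n) (g : Fpⁿ p n → ℤ) → Σᵥ n (λ x → 𝟙 (a ≟ᵥ x) * g x) ≡ g a
  Σᵥ-𝟙 zero    []      g = ℤ.*-identityˡ (g [])
  Σᵥ-𝟙 (suc n) (a ∷ u) g = begin
    ∑[ c < p ] Σᵥ n (λ v → 𝟙 (a ∷ u ≟ᵥ c ∷ v) * g (c ∷ v))          ≡⟨ sum-cong-≗ (λ c → Σᵥ-cong n (λ v →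
                                                                          cong (_* g (c ∷ v)) (𝟙-∷ _≟ᶠ_ a c u v))) ⟩
    ∑[ c < p ] Σᵥ n (λ v → 𝟙 (a ≟ᶠ c) * 𝟙 (u ≟ᵥ v) * g (c ∷ v))     ≡⟨ sum-cong-≗ (λ c → Σᵥ-cong n (λ v →
                                                                          ℤ.*-assoc (𝟙 (a ≟ᶠ c)) (𝟙 (u ≟ᵥ v)) (g (c ∷ v)))) ⟩
    ∑[ c < p ] Σᵥ n (λ v → 𝟙 (a ≟ᶠ c) * (𝟙 (u ≟ᵥ v) * g (c ∷ v)))   ≡⟨ sum-cong-≗ (λ c →
                                                                          sym (*-distribˡ-Σᵥ n (𝟙 (a ≟ᶠ c)) _)) ⟩
    ∑[ c < p ] (𝟙 (a ≟ᶠ c) * Σᵥ n (λ v → 𝟙 (u ≟ᵥ v) * g (c ∷ v)))   ≡⟨ sum-cong-≗ (λ c →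
                                                                          cong (_*_ (𝟙 (a ≟ᶠ c))) (Σᵥ-𝟙 n u _)) ⟩
    ∑[ c < p ] (𝟙 (a ≟ᶠ c) * g (c ∷ u))                             ≡⟨ sum-𝟙 a _ ⟩
    g (a ∷ u)                                                        ∎
    where open ≡-Reasoning

  Σᵥ-punctured : ∀ n (a : Fpⁿ p n) (g : Fpⁿ p n → ℤ) →
                 Σᵥ n (λ x → if does (x ≟ᵥ a) then 0ℤ else g x) ≡ Σᵥ n g - g a
  Σᵥ-punctured n a g = begin
    Σᵥ n (λ x → if does (x ≟ᵥ a) then 0ℤ else g x)  ≡⟨ Σᵥ-cong n pointwise ⟩
    Σᵥ n (λ x → g x - 𝟙 (a ≟ᵥ x) * g x)            ≡⟨ Σᵥ-distrib-sub n g _ ⟩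
    Σᵥ n g - Σᵥ n (λ x → 𝟙 (a ≟ᵥ x) * g x)          ≡⟨ cong (_-_ (Σᵥ n g)) (Σᵥ-𝟙 n a g) ⟩
    Σᵥ n g - g a                                     ∎
    where
    open ≡-Reasoning
    pointwise : ∀ x → (if does (x ≟ᵥ a) then 0ℤ else g x) ≡ g x - 𝟙 (a ≟ᵥ x) * g x
    pointwise x with x ≟ᵥ a | a ≟ᵥ x
    ... | yes _   | yes _   = sym (trans (cong (_-_ (g x)) (ℤ.*-identityˡ (g x))) (ℤ.+-inverseʳ (g x)))
    ... | no _    | no _    = sym (ℤ.+-identityʳ (g x))
    ... | yes x≡a | no a≢x  = contradiction (sym x≡a) a≢x
    ... | no x≢a  | yes a≡x = contradiction (sym a≡x) x≢a

module Orthogonality (p : ℕ) .{{_ : NonZero p}} (p-prime : Prime p) where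

  open import Data.Integer using (_+_; _*_; _-_)
  open PrimeField p
  open FinSums
  open VecSums p

  ·-level-set-size : ∀ n (d : Fpⁿ p n) → d ≢ zeroVec p n → ∀ k →
                     + p * Σᵥ n (λ b → 𝟙 (b · d ≟ᶠ k)) ≡ pᵢ^ n
  ·-level-set-size zero    []      d≢0 k = contradiction refl d≢0
  ·-level-set-size (suc n) (e ∷ d) e∷d≢0 k with d ≟ᵥ zeroVec p n
  ... | yes refl = trans (cong (_*_ (+ p)) (begin
    ∑[ c < p ] Σᵥ n (λ b → 𝟙 (c ⊗ e ⊕ b · zeroVec p n ≟ᶠ k))   ≡⟨ sum-cong-≗ {p} (λ c → Σᵥ-cong n (λ b →
                                                                   cong (λ t → 𝟙 (c ⊗ e ⊕ t ≟ᶠ k)) (·-zeroʳ b))) ⟩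
    ∑[ c < p ] Σᵥ n (λ _ → 𝟙 (c ⊗ e ⊕ 0# ≟ᶠ k))                ≡⟨ sum-cong-≗ {p} (λ c → Σᵥ-const n _) ⟩
    ∑[ c < p ] (pᵢ^ n * 𝟙 (c ⊗ e ⊕ 0# ≟ᶠ k))                   ≡⟨ sum-cong-≗ {p} (λ c →
                                                                   trans (ℤ.*-comm (pᵢ^ n) _) (cong (_* pᵢ^ n) (solution c))) ⟩
    ∑[ c < p ] (𝟙 (k ⊗ e⁻¹ ≟ᶠ c) * pᵢ^ n)                      ≡⟨ sum-𝟙 (k ⊗ e⁻¹) (λ _ → pᵢ^ n) ⟩
    pᵢ^ n                                                       ∎)) (p*pᵢ^ n)
    where
    open ≡-Reasoning
    e≢0 : e ≢ 0#
    e≢0 e≡0 = e∷d≢0 (cong (_∷ zeroVec p n) e≡0)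
    e⁻¹ = proj₁ (⊗-inverse p-prime e e≢0)
    e⊗e⁻¹≡1 = proj₂ (⊗-inverse p-prime e e≢0)
    solution : ∀ c → 𝟙 (c ⊗ e ⊕ 0# ≟ᶠ k) ≡ 𝟙 (k ⊗ e⁻¹ ≟ᶠ c)
    solution c = 𝟙-⇔ (mk⇔ (λ eq → sym (⊗-scale e⊗e⁻¹≡1 c k (trans (sym (+-identityʳ _)) eq)))
                           (λ eq → trans (+-identityʳ _) (⊗-unscale e⊗e⁻¹≡1 c k (sym eq))))
                     (c ⊗ e ⊕ 0# ≟ᶠ k) (k ⊗ e⁻¹ ≟ᶠ c)
  ... | no d≢0 = begin
    + p * ∑[ c < p ] Σᵥ n (λ b → 𝟙 (c ⊗ e ⊕ b · d ≟ᶠ k))        ≡⟨ *-distribˡ-sum (+ p) (λ c → Σᵥ n (λ b → 𝟙 (c ⊗ e ⊕ b · d ≟ᶠ k))) ⟩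
    ∑[ c < p ] (+ p * Σᵥ n (λ b → 𝟙 (c ⊗ e ⊕ b · d ≟ᶠ k)))      ≡⟨ sum-cong-≗ {p} (λ c → cong (_*_ (+ p)) (Σᵥ-cong n (λ b →
                                                                   𝟙-⇔ (mk⇔ (⊕-shift _ _ k) (⊕-unshift _ _ k)) (c ⊗ e ⊕ b · d ≟ᶠ k) (b · d ≟ᶠ k ⊖ c ⊗ e)))) ⟩
    ∑[ c < p ] (+ p * Σᵥ n (λ b → 𝟙 (b · d ≟ᶠ k ⊖ c ⊗ e)))      ≡⟨ sum-cong-≗ {p} (λ c → ·-level-set-size n d d≢0 (k ⊖ c ⊗ e)) ⟩
    ∑[ c < p ] pᵢ^ n                                             ≡⟨ sum-const p (pᵢ^ n) ⟩
    + p * pᵢ^ n                                                  ≡⟨ p*pᵢ^ n ⟩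
    pᵢ^ (suc n)                                                  ∎
    where open ≡-Reasoning

  ·-agreement-count : ∀ m (u v : Fpⁿ p m) →
    + p * Σᵥ m (λ b → 𝟙 (b · u ≟ᶠ b · v)) - pᵢ^ m ≡ (pᵢ^ (suc m) - pᵢ^ m) * 𝟙 (u ≟ᵥ v)
  ·-agreement-count m u v with u ≟ᵥ v
  ... | yes refl = begin
    + p * Σᵥ m (λ b → 𝟙 (b · u ≟ᶠ b · u)) - pᵢ^ m     ≡⟨ cong (λ s → + p * s - pᵢ^ m) (Σᵥ-cong m (λ b → 𝟙-yes (b · u ≟ᶠ b · u) refl)) ⟩
    + p * Σᵥ m (λ _ → 1ℤ) - pᵢ^ m                     ≡⟨ cong (λ s → + p * s - pᵢ^ m) (trans (Σᵥ-const m 1ℤ) (ℤ.*-identityʳ (pᵢ^ m))) ⟩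
    + p * pᵢ^ m - pᵢ^ m                               ≡⟨ cong (_- pᵢ^ m) (p*pᵢ^ m) ⟩
    pᵢ^ (suc m) - pᵢ^ m                               ≡⟨ ℤ.*-identityʳ (pᵢ^ (suc m) - pᵢ^ m) ⟨
    (pᵢ^ (suc m) - pᵢ^ m) * 1ℤ                        ∎
    where open ≡-Reasoning
  ... | no u≢v = begin
    + p * Σᵥ m (λ b → 𝟙 (b · u ≟ᶠ b · v)) - pᵢ^ m     ≡⟨ cong (λ s → + p * s - pᵢ^ m) (Σᵥ-cong m (λ b →
                                                           𝟙-⇔ (agree b) (b · u ≟ᶠ b · v) (b · (u ⊖ᵥ v) ≟ᶠ 0#))) ⟩
    + p * Σᵥ m (λ b → 𝟙 (b · (u ⊖ᵥ v) ≟ᶠ 0#)) - pᵢ^ m  ≡⟨ cong (_- pᵢ^ m) (·-level-set-size m (u ⊖ᵥ v) (u≢v ∘ ⊖ᵥ≡0⇒≡ u v) 0#) ⟩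
    pᵢ^ m - pᵢ^ m                                     ≡⟨ ℤ.+-inverseʳ (pᵢ^ m) ⟩
    0ℤ                                                ≡⟨ ℤ.*-zeroʳ (pᵢ^ (suc m) - pᵢ^ m) ⟨
    (pᵢ^ (suc m) - pᵢ^ m) * 0ℤ                        ∎
    where
    open ≡-Reasoning
    agree : ∀ b → b · u ≡ b · v ⇔ b · (u ⊖ᵥ v) ≡ 0#
    agree b = mk⇔ (λ eq → trans (·-distribˡ-⊖ᵥ b u v) (trans (cong (_⊖ b · v) eq) (-‿inverseʳ (b · v))))
                  (λ eq → x∙y⁻¹≈ε⇒x≈y (b · u) (b · v) (trans (sym (·-distribˡ-⊖ᵥ b u v)) eq))

module CyclotomicTrace (p : ℕ) .{{_ : NonZero p}} where

  open import Data.Integer using (_+_; _*_; _-_)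
  open PrimeField p
  open FinSums
  open VecSums p

  -- The field trace of ℚ(ζ_p): Tr ζ^k is p - 1 for k = 0 and -1 otherwise.
  trace : Cyc p → ℤ
  trace u = + p * u 0# - ∑[ k < p ] u k

  trace-resp-≈ᶜ : ∀ {u v} → _≈ᶜ_ p u v → trace u ≡ trace v
  trace-resp-≈ᶜ {u} {v} (c , u-v≡c) = begin
    + p * u 0# - ∑[ k < p ] u k                     ≡⟨ cong₂ (λ a s → + p * a - s) (u≡v+c 0#) (sum-cong-≗ {p} u≡v+c) ⟩
    + p * (v 0# + c) - ∑[ k < p ] (v k + c)         ≡⟨ cong (_-_ (+ p * (v 0# + c))) (∑-distrib-+ v (λ _ → c)) ⟩
    + p * (v 0# + c) - (sum v + ∑[ k < p ] c)       ≡⟨ cong (λ s → + p * (v 0# + c) - (sum v + s)) (sum-const p c) ⟩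
    + p * (v 0# + c) - (sum v + + p * c)            ≡⟨ cancel (+ p) (v 0#) c (sum v) ⟩
    + p * v 0# - sum v                              ∎
    where
    open ≡-Reasoning
    u≡v+c : ∀ k → u k ≡ v k + c
    u≡v+c k = trans (split (u k) (v k)) (cong (_+_ (v k)) (u-v≡c k))
      where
      split : ∀ a b → a ≡ b + (a - b)
      split = solve-∀
    cancel : ∀ q a c s → q * (a + c) - (s + q * c) ≡ q * a - s
    cancel = solve-∀

  ι≗𝟙 : ∀ r k → ι p r k ≡ 𝟙 (0# ≟ᶠ k) * r
  ι≗𝟙 r k with 0# ≟ᶠ k
  ... | yes _ = sym (ℤ.*-identityˡ r)
  ... | no _  = refl

  trace-ι : ∀ r → trace (ι p r) ≡ (+ p - 1ℤ) * r
  trace-ι r = begin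
    + p * ι p r 0# - ∑[ k < p ] ι p r k             ≡⟨ cong₂ (λ a s → + p * a - s)
                                                        (trans (ι≗𝟙 r 0#) (cong (_* r) (𝟙-yes (0# ≟ᶠ 0#) refl)))
                                                        (trans (sum-cong-≗ {p} (ι≗𝟙 r)) (sum-𝟙 0# (λ _ → r))) ⟩
    + p * (1ℤ * r) - r                              ≡⟨ cong (λ a → + p * a - r) (ℤ.*-identityˡ r) ⟩
    + p * r - r                                     ≡⟨ factor (+ p) r ⟩
    (+ p - 1ℤ) * r                                  ∎
    where
    open ≡-Reasoning
    factor : ∀ q r → q * r - r ≡ (q - 1ℤ) * r
    factor = solve-∀

  trace-0ᶜ : trace (0ᶜ p) ≡ 0ℤ
  trace-0ᶜ = cong₂ _-_ (ℤ.*-zeroʳ (+ p)) (sum-zero p)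

  ΣFin≡sum : ∀ {k} (f : Fin k → ℤ) → ΣFin p _+_ 0ℤ k f ≡ sum f
  ΣFin≡sum {zero}  f = refl
  ΣFin≡sum {suc k} f = cong (_+_ (f Fin.zero)) (ΣFin≡sum (f ∘ Fin.suc))

  ΣFin-apply : ∀ {k} (f : Fin k → Cyc p) j → ΣFin p (_+ᶜ_ p) (0ᶜ p) k f j ≡ ∑[ i < k ] f i j
  ΣFin-apply {zero}  f j = refl
  ΣFin-apply {suc k} f j = cong (_+_ (f Fin.zero j)) (ΣFin-apply (f ∘ Fin.suc) j)

  ΣVec-apply : ∀ n (f : Fpⁿ p n → Cyc p) j → ΣVec p (_+ᶜ_ p) (0ᶜ p) n f j ≡ Σᵥ n (λ x → f x j)
  ΣVec-apply zero    f j = refl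
  ΣVec-apply (suc n) f j = trans (ΣFin-apply (λ c → ΣVec p (_+ᶜ_ p) (0ᶜ p) n (λ v → f (c ∷ v))) j)
                                 (sum-cong-≗ {p} (λ c → ΣVec-apply n (λ v → f (c ∷ v)) j))

  trace-ΣVec : ∀ n (f : Fpⁿ p n → Cyc p) → trace (ΣVec p (_+ᶜ_ p) (0ᶜ p) n f) ≡ Σᵥ n (λ x → trace (f x))
  trace-ΣVec n f = begin
    + p * ΣVec p (_+ᶜ_ p) (0ᶜ p) n f 0# - ∑[ k < p ] ΣVec p (_+ᶜ_ p) (0ᶜ p) n f k
      ≡⟨ cong₂ (λ a s → + p * a - s) (ΣVec-apply n f 0#) (sum-cong-≗ {p} (ΣVec-apply n f)) ⟩
    + p * Σᵥ n (λ x → f x 0#) - ∑[ k < p ] Σᵥ n (λ x → f x k)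
      ≡⟨ cong₂ _-_ (*-distribˡ-Σᵥ n (+ p) (λ x → f x 0#)) (sym (Σᵥ-comm-sum n (λ x k → f x k))) ⟩
    Σᵥ n (λ x → + p * f x 0#) - Σᵥ n (λ x → ∑[ k < p ] f x k)
      ≡⟨ Σᵥ-distrib-sub n _ _ ⟨
    Σᵥ n (λ x → trace (f x))
      ∎
    where open ≡-Reasoning

  sum-reflect : ∀ i (f : Fp p → ℤ) → ∑[ k < p ] f (i ⊖ k) ≡ sum f
  sum-reflect i f = sym (sum-permute f (permutation (i ⊖_) (i ⊖_) involutive involutive))
    where
    involutive : ∀ k → i ⊖ (i ⊖ k) ≡ k
    involutive k = trans (cong (i ⊕_) (⁻¹-anti-homo‿- i k)) (trans (⊕-comm i (k ⊖ i)) (//-rightDividesˡ i k))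

  trace-∣∣² : ∀ u → trace (∣_∣² p u) ≡ + p * ∑[ i < p ] (u i * u i) - sum u * sum u
  trace-∣∣² u = cong₂ (λ a s → + p * a - s) at-0 total
    where
    open ≡-Reasoning
    at-0 : ∣_∣² p u 0# ≡ ∑[ i < p ] (u i * u i)
    at-0 = trans (ΣFin≡sum (λ i → u i * u (⊝ (0# ⊖ i)))) (sum-cong-≗ {p} (λ i → cong (λ j → u i * u j)
             (trans (⁻¹-anti-homo‿- 0# i) (⊖-identityʳ i))))
    total : ∑[ k < p ] ∣_∣² p u k ≡ sum u * sum u
    total = begin
      ∑[ k < p ] ∣_∣² p u k                          ≡⟨ sum-cong-≗ {p} (λ k → ΣFin≡sum (λ i → u i * u (⊝ (k ⊖ i)))) ⟩
      ∑[ k < p ] ∑[ i < p ] (u i * u (⊝ (k ⊖ i)))    ≡⟨ ∑-comm (λ k i → u i * u (⊝ (k ⊖ i))) ⟩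
      ∑[ i < p ] ∑[ k < p ] (u i * u (⊝ (k ⊖ i)))    ≡⟨ sum-cong-≗ {p} (λ i → sym (*-distribˡ-sum (u i) (λ k → u (⊝ (k ⊖ i))))) ⟩
      ∑[ i < p ] (u i * ∑[ k < p ] u (⊝ (k ⊖ i)))    ≡⟨ sum-cong-≗ {p} (λ i → cong (_*_ (u i))
                                                          (trans (sum-cong-≗ {p} (λ k → cong u (⁻¹-anti-homo‿- k i)))
                                                                 (sum-reflect i u))) ⟩
      ∑[ i < p ] (u i * sum u)                       ≡⟨ *-distribʳ-sum (sum u) u ⟨
      sum u * sum u                                  ∎

module Fibres (p : ℕ) .{{_ : NonZero p}} where

  open import Data.Integer using (_+_; _*_)
  open FinSums
  open VecSums p

  fibres-sum : ∀ n (e : Fpⁿ p n → Fp p) → ∑[ i < p ] Σᵥ n (λ x → 𝟙 (e x ≟ᶠ i)) ≡ pᵢ^ n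
  fibres-sum n e = begin
    ∑[ i < p ] Σᵥ n (λ x → 𝟙 (e x ≟ᶠ i))     ≡⟨ Σᵥ-comm-sum n (λ x i → 𝟙 (e x ≟ᶠ i)) ⟨
    Σᵥ n (λ x → ∑[ i < p ] 𝟙 (e x ≟ᶠ i))     ≡⟨ Σᵥ-cong n (λ x → trans (sum-cong-≗ {p} (λ i → sym (ℤ.*-identityʳ _)))
                                                                    (sum-𝟙 (e x) (λ _ → 1ℤ))) ⟩
    Σᵥ n (λ _ → 1ℤ)                          ≡⟨ trans (Σᵥ-const n 1ℤ) (ℤ.*-identityʳ (pᵢ^ n)) ⟩
    pᵢ^ n                                    ∎
    where open ≡-Reasoning

  fibres-sum² : ∀ n (e : Fpⁿ p n → Fp p) →
                ∑[ i < p ] (Σᵥ n (λ x → 𝟙 (e x ≟ᶠ i)) * Σᵥ n (λ x → 𝟙 (e x ≟ᶠ i)))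
                  ≡ Σᵥ n (λ x → Σᵥ n (λ x′ → 𝟙 (e x ≟ᶠ e x′)))
  fibres-sum² n e = begin
    ∑[ i < p ] (Σᵥ n (λ x → 𝟙 (e x ≟ᶠ i)) * Σᵥ n (λ x → 𝟙 (e x ≟ᶠ i)))
      ≡⟨ sum-cong-≗ {p} (λ i → Σᵥ-*-Σᵥ n (λ x → 𝟙 (e x ≟ᶠ i)) (λ x → 𝟙 (e x ≟ᶠ i))) ⟩
    ∑[ i < p ] Σᵥ n (λ x → Σᵥ n (λ x′ → 𝟙 (e x ≟ᶠ i) * 𝟙 (e x′ ≟ᶠ i)))
      ≡⟨ Σᵥ-comm-sum n (λ x i → Σᵥ n (λ x′ → 𝟙 (e x ≟ᶠ i) * 𝟙 (e x′ ≟ᶠ i))) ⟨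
    Σᵥ n (λ x → ∑[ i < p ] Σᵥ n (λ x′ → 𝟙 (e x ≟ᶠ i) * 𝟙 (e x′ ≟ᶠ i)))
      ≡⟨ Σᵥ-cong n (λ x → sym (Σᵥ-comm-sum n (λ x′ i → 𝟙 (e x ≟ᶠ i) * 𝟙 (e x′ ≟ᶠ i)))) ⟩
    Σᵥ n (λ x → Σᵥ n (λ x′ → ∑[ i < p ] (𝟙 (e x ≟ᶠ i) * 𝟙 (e x′ ≟ᶠ i))))
      ≡⟨ Σᵥ-cong n (λ x → Σᵥ-cong n (λ x′ → trans (sum-𝟙 (e x) (λ i → 𝟙 (e x′ ≟ᶠ i))) (𝟙-sym _≟ᶠ_ (e x′) (e x)))) ⟩
    Σᵥ n (λ x → Σᵥ n (λ x′ → 𝟙 (e x ≟ᶠ e x′)))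
      ∎
    where open ≡-Reasoning

  Σᵥ-fibres : ∀ n m (F : Fpⁿ p n → Fpⁿ p m) → Σᵥ m (λ y → Σᵥ n (λ x → 𝟙 (F x ≟ᵥ y))) ≡ pᵢ^ n
  Σᵥ-fibres n m F = begin
    Σᵥ m (λ y → Σᵥ n (λ x → 𝟙 (F x ≟ᵥ y)))   ≡⟨ Σᵥ-comm n m (λ x y → 𝟙 (F x ≟ᵥ y)) ⟨
    Σᵥ n (λ x → Σᵥ m (λ y → 𝟙 (F x ≟ᵥ y)))   ≡⟨ Σᵥ-cong n (λ x → trans (Σᵥ-cong m (λ y → sym (ℤ.*-identityʳ _)))
                                                                    (Σᵥ-𝟙 m (F x) (λ _ → 1ℤ))) ⟩
    Σᵥ n (λ _ → 1ℤ)                          ≡⟨ trans (Σᵥ-const n 1ℤ) (ℤ.*-identityʳ (pᵢ^ n)) ⟩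
    pᵢ^ n                                    ∎
    where open ≡-Reasoning

  Σᵥ-fibres² : ∀ n m (F : Fpⁿ p n → Fpⁿ p m) →
               Σᵥ m (λ y → Σᵥ n (λ x → 𝟙 (F x ≟ᵥ y)) * Σᵥ n (λ x → 𝟙 (F x ≟ᵥ y)))
                 ≡ Σᵥ n (λ x → Σᵥ n (λ x′ → 𝟙 (F x ≟ᵥ F x′)))
  Σᵥ-fibres² n m F = begin
    Σᵥ m (λ y → Σᵥ n (λ x → 𝟙 (F x ≟ᵥ y)) * Σᵥ n (λ x → 𝟙 (F x ≟ᵥ y)))
      ≡⟨ Σᵥ-cong m (λ y → Σᵥ-*-Σᵥ n (λ x → 𝟙 (F x ≟ᵥ y)) (λ x → 𝟙 (F x ≟ᵥ y))) ⟩
    Σᵥ m (λ y → Σᵥ n (λ x → Σᵥ n (λ x′ → 𝟙 (F x ≟ᵥ y) * 𝟙 (F x′ ≟ᵥ y))))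
      ≡⟨ Σᵥ-comm n m (λ x y → Σᵥ n (λ x′ → 𝟙 (F x ≟ᵥ y) * 𝟙 (F x′ ≟ᵥ y))) ⟨
    Σᵥ n (λ x → Σᵥ m (λ y → Σᵥ n (λ x′ → 𝟙 (F x ≟ᵥ y) * 𝟙 (F x′ ≟ᵥ y))))
      ≡⟨ Σᵥ-cong n (λ x → sym (Σᵥ-comm n m (λ x′ y → 𝟙 (F x ≟ᵥ y) * 𝟙 (F x′ ≟ᵥ y)))) ⟩
    Σᵥ n (λ x → Σᵥ n (λ x′ → Σᵥ m (λ y → 𝟙 (F x ≟ᵥ y) * 𝟙 (F x′ ≟ᵥ y))))
      ≡⟨ Σᵥ-cong n (λ x → Σᵥ-cong n (λ x′ → trans (Σᵥ-𝟙 m (F x) (λ y → 𝟙 (F x′ ≟ᵥ y))) (𝟙-sym _≟ᵥ_ (F x′) (F x)))) ⟩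
    Σᵥ n (λ x → Σᵥ n (λ x′ → 𝟙 (F x ≟ᵥ F x′)))
      ∎
    where open ≡-Reasoning

module CauchySchwarz (p : ℕ) .{{_ : NonZero p}} where

  open import Data.Integer using (_+_; _*_; _-_; -_; _≤_)
  open VecSums p

  cauchy-schwarz : ∀ m (t f : Fpⁿ p m → ℤ) → .{{ℤ.Positive (Σᵥ m (λ y → t y * t y))}} →
                   Σᵥ m (λ y → t y * f y) * Σᵥ m (λ y → t y * f y)
                     ≤ Σᵥ m (λ y → t y * t y) * Σᵥ m (λ y → f y * f y)
  cauchy-schwarz m t f = ℤ.0≤i-j⇒j≤i (ℤ.*-cancelˡ-≤-pos 0ℤ (A * C - B * B) A
                           (subst₂ _≤_ (sym (ℤ.*-zeroʳ A)) sum-of-squares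
                             (Σᵥ-nonneg m _ (λ y → square-nonneg (A * f y - B * t y)))))
    where
    open ≡-Reasoning
    A = Σᵥ m (λ y → t y * t y)
    B = Σᵥ m (λ y → t y * f y)
    C = Σᵥ m (λ y → f y * f y)
    expand : ∀ A B t f → (A * f - B * t) * (A * f - B * t) ≡ (A * A) * (f * f) + (- (A * B + A * B)) * (t * f) + (B * B) * (t * t)
    expand = solve-∀
    collect : ∀ A B C → (A * A) * C + (- (A * B + A * B)) * B + (B * B) * A ≡ A * (A * C - B * B)
    collect = solve-∀
    sum-of-squares : Σᵥ m (λ y → (A * f y - B * t y) * (A * f y - B * t y)) ≡ A * (A * C - B * B)
    sum-of-squares = begin
      Σᵥ m (λ y → (A * f y - B * t y) * (A * f y - B * t y))
        ≡⟨ Σᵥ-cong m (λ y → expand A B (t y) (f y)) ⟩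
      Σᵥ m (λ y → (A * A) * (f y * f y) + (- (A * B + A * B)) * (t y * f y) + (B * B) * (t y * t y))
        ≡⟨ trans (Σᵥ-distrib-+ m _ _) (cong (_+ Σᵥ m (λ y → (B * B) * (t y * t y))) (Σᵥ-distrib-+ m _ _)) ⟩
      Σᵥ m (λ y → (A * A) * (f y * f y)) + Σᵥ m (λ y → (- (A * B + A * B)) * (t y * f y)) + Σᵥ m (λ y → (B * B) * (t y * t y))
        ≡⟨ cong₂ _+_ (cong₂ _+_ (*-distribˡ-Σᵥ m (A * A) _) (*-distribˡ-Σᵥ m (- (A * B + A * B)) _))
                     (*-distribˡ-Σᵥ m (B * B) _) ⟨
      (A * A) * C + (- (A * B + A * B)) * B + (B * B) * A
        ≡⟨ collect A B C ⟩
      A * (A * C - B * B)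
        ∎

module Imbalance (p : ℕ) .{{_ : NonZero p}} (p-prime : Prime p) {n m : ℕ} (F : Fpⁿ p n → Fpⁿ p m) where

  open import Data.Integer using (_+_; _*_; _-_; _≤_)
  open PrimeField p
  open VecSums p
  open CyclotomicTrace p
  open Fibres p
  open Orthogonality p p-prime
  open CauchySchwarz p

  collisions : ℤ
  collisions = Σᵥ n (λ x → Σᵥ n (λ x′ → 𝟙 (F x ≟ᵥ F x′)))

  agreements : Fpⁿ p m → ℤ
  agreements b = Σᵥ n (λ x → Σᵥ n (λ x′ → 𝟙 (b · F x ≟ᶠ b · F x′)))

  W-apply : ∀ b i → W p F b (zeroVec p n) i ≡ Σᵥ n (λ x → 𝟙 (b · F x ≟ᶠ i))
  W-apply b i = trans (ΣVec-apply n _ i) (Σᵥ-cong n (λ x →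
    cong (λ a → 𝟙 (a ≟ᶠ i)) (trans (cong (b · F x ⊖_) (·-zeroˡ x)) (⊖-identityʳ (b · F x)))))

  trace-∣W∣² : ∀ b → trace (∣_∣² p (W p F b (zeroVec p n))) ≡ + p * agreements b - pᵢ^ n * pᵢ^ n
  trace-∣W∣² b = begin
    trace (∣_∣² p Wb)                                        ≡⟨ trace-∣∣² Wb ⟩
    + p * ∑[ i < p ] (Wb i * Wb i) - sum Wb * sum Wb         ≡⟨ cong₂ (λ s t → + p * s - t * t)
                                                                  (trans (sum-cong-≗ {p} (λ i → cong₂ _*_ (W-apply b i) (W-apply b i)))
                                                                         (fibres-sum² n (λ x → b · F x)))
                                                                  (trans (sum-cong-≗ {p} (W-apply b)) (fibres-sum n (λ x → b · F x))) ⟩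
    + p * agreements b - pᵢ^ n * pᵢ^ n                       ∎
    where
    open ≡-Reasoning
    Wb = W p F b (zeroVec p n)

  agreements-zero : agreements (zeroVec p m) ≡ pᵢ^ n * pᵢ^ n
  agreements-zero = begin
    Σᵥ n (λ x → Σᵥ n (λ x′ → 𝟙 (zeroVec p m · F x ≟ᶠ zeroVec p m · F x′)))
      ≡⟨ Σᵥ-cong n (λ x → Σᵥ-cong n (λ x′ → 𝟙-yes (zeroVec p m · F x ≟ᶠ zeroVec p m · F x′) (trans (·-zeroˡ (F x)) (sym (·-zeroˡ (F x′)))))) ⟩
    Σᵥ n (λ _ → Σᵥ n (λ _ → 1ℤ))
      ≡⟨ trans (Σᵥ-cong n (λ _ → trans (Σᵥ-const n 1ℤ) (ℤ.*-identityʳ (pᵢ^ n)))) (Σᵥ-const n (pᵢ^ n)) ⟩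
    pᵢ^ n * pᵢ^ n
      ∎
    where open ≡-Reasoning

  agreements-sum : + p * Σᵥ m agreements - pᵢ^ m * (pᵢ^ n * pᵢ^ n) ≡ (pᵢ^ (suc m) - pᵢ^ m) * collisions
  agreements-sum = begin
    + p * Σᵥ m agreements - pᵢ^ m * (pᵢ^ n * pᵢ^ n)
      ≡⟨ cong₂ (λ s t → + p * s - t) (trans (Σᵥ-comm m n _) (Σᵥ-cong n (λ x → Σᵥ-comm m n _))) (rearrange (pᵢ^ m) (pᵢ^ n)) ⟩
    + p * Σᵥ n (λ x → Σᵥ n (λ x′ → agree x x′)) - pᵢ^ n * (pᵢ^ n * pᵢ^ m)
      ≡⟨ trans (Σᵥ-cong n (λ x → Σᵥ-affine n (+ p) (pᵢ^ m) (agree x))) (Σᵥ-affine n (+ p) _ _) ⟨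
    Σᵥ n (λ x → Σᵥ n (λ x′ → + p * agree x x′ - pᵢ^ m))
      ≡⟨ Σᵥ-cong n (λ x → Σᵥ-cong n (λ x′ → ·-agreement-count m (F x) (F x′))) ⟩
    Σᵥ n (λ x → Σᵥ n (λ x′ → (pᵢ^ (suc m) - pᵢ^ m) * 𝟙 (F x ≟ᵥ F x′)))
      ≡⟨ trans (*-distribˡ-Σᵥ n D (λ x → Σᵥ n (λ x′ → 𝟙 (F x ≟ᵥ F x′))))
               (Σᵥ-cong n (λ x → *-distribˡ-Σᵥ n D (λ x′ → 𝟙 (F x ≟ᵥ F x′)))) ⟨
    (pᵢ^ (suc m) - pᵢ^ m) * collisions
      ∎
    where
    open ≡-Reasoning
    D = pᵢ^ (suc m) - pᵢ^ m
    agree : Fpⁿ p n → Fpⁿ p n → ℤ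
    agree x x′ = Σᵥ m (λ b → 𝟙 (b · F x ≟ᶠ b · F x′))
    rearrange : ∀ M P → M * (P * P) ≡ P * (P * M)
    rearrange = solve-∀

  trace-imbalanceSum : trace (imbalanceSum p F) ≡ (+ p - 1ℤ) * (pᵢ^ m * collisions - pᵢ^ n * pᵢ^ n)
  trace-imbalanceSum = begin
    trace (imbalanceSum p F)
      ≡⟨ trace-ΣVec m _ ⟩
    Σᵥ m (λ b → trace (if does (b ≟ᵥ zeroVec p m) then 0ᶜ p else ∣_∣² p (W p F b (zeroVec p n))))
      ≡⟨ Σᵥ-cong m (λ b → trans (if-float trace (does (b ≟ᵥ zeroVec p m)))
                                (cong₂ (if_then_else_ (does (b ≟ᵥ zeroVec p m))) trace-0ᶜ (trace-∣W∣² b))) ⟩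
    Σᵥ m (λ b → if does (b ≟ᵥ zeroVec p m) then 0ℤ else (+ p * agreements b - pᵢ^ n * pᵢ^ n))
      ≡⟨ Σᵥ-punctured m (zeroVec p m) _ ⟩
    Σᵥ m (λ b → + p * agreements b - pᵢ^ n * pᵢ^ n) - (+ p * agreements (zeroVec p m) - pᵢ^ n * pᵢ^ n)
      ≡⟨ cong₂ _-_ (Σᵥ-affine m (+ p) _ agreements) (cong (λ a → + p * a - pᵢ^ n * pᵢ^ n) agreements-zero) ⟩
    (+ p * Σᵥ m agreements - pᵢ^ m * (pᵢ^ n * pᵢ^ n)) - (+ p * (pᵢ^ n * pᵢ^ n) - pᵢ^ n * pᵢ^ n)
      ≡⟨ cong (_- (+ p * (pᵢ^ n * pᵢ^ n) - pᵢ^ n * pᵢ^ n)) agreements-sum ⟩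
    (pᵢ^ (suc m) - pᵢ^ m) * collisions - (+ p * (pᵢ^ n * pᵢ^ n) - pᵢ^ n * pᵢ^ n)
      ≡⟨ cong (λ q → (q - pᵢ^ m) * collisions - (+ p * (pᵢ^ n * pᵢ^ n) - pᵢ^ n * pᵢ^ n)) (p*pᵢ^ m) ⟨
    (+ p * pᵢ^ m - pᵢ^ m) * collisions - (+ p * (pᵢ^ n * pᵢ^ n) - pᵢ^ n * pᵢ^ n)
      ≡⟨ factor (+ p) (pᵢ^ m) collisions (pᵢ^ n) ⟩
    (+ p - 1ℤ) * (pᵢ^ m * collisions - pᵢ^ n * pᵢ^ n)
      ∎
    where
    open ≡-Reasoning
    factor : ∀ q M C P → (q * M - M) * C - (q * (P * P) - P * P) ≡ (q - 1ℤ) * (M * C - P * P)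
    factor = solve-∀

  fibre : Fpⁿ p m → ℤ
  fibre y = Σᵥ n (λ x → 𝟙 (F x ≟ᵥ y))

  missed-value⇒collisions-bound : ∀ y₀ → (∀ x → F x ≢ y₀) → 1 ℕ.< p ℕ.^ m →
                                  pᵢ^ n * pᵢ^ n ≤ (pᵢ^ m - 1ℤ) * collisions
  missed-value⇒collisions-bound y₀ missed 1<pᵐ =
    subst₂ _≤_ (cong₂ _*_ Σt·fibre Σt·fibre) (cong₂ _*_ Σt² (Σᵥ-fibres² n m F))
      (cauchy-schwarz m t fibre {{subst ℤ.Positive (sym Σt²) (+q-1-positive 1<pᵐ)}})
    where
    t : Fpⁿ p m → ℤ
    t y = if does (y ≟ᵥ y₀) then 0ℤ else 1ℤ
    fibre-y₀ : fibre y₀ ≡ 0ℤ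
    fibre-y₀ = trans (Σᵥ-cong n (λ x → 𝟙-no (F x ≟ᵥ y₀) (missed x))) (trans (Σᵥ-const n 0ℤ) (ℤ.*-zeroʳ (pᵢ^ n)))
    t² : ∀ y → t y * t y ≡ t y
    t² y with does (y ≟ᵥ y₀)
    ... | true  = refl
    ... | false = refl
    t·fibre : ∀ y → t y * fibre y ≡ fibre y
    t·fibre y with y ≟ᵥ y₀
    ... | yes refl = trans (ℤ.*-zeroˡ (fibre y₀)) (sym fibre-y₀)
    ... | no _     = ℤ.*-identityˡ (fibre y)
    Σt² : Σᵥ m (λ y → t y * t y) ≡ pᵢ^ m - 1ℤ
    Σt² = trans (Σᵥ-cong m t²) (trans (Σᵥ-punctured m y₀ (λ _ → 1ℤ)) (cong (_- 1ℤ) (trans (Σᵥ-const m 1ℤ) (ℤ.*-identityʳ (pᵢ^ m)))))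
    Σt·fibre : Σᵥ m (λ y → t y * fibre y) ≡ pᵢ^ n
    Σt·fibre = trans (Σᵥ-cong m t·fibre) (Σᵥ-fibres n m F)

  imbalance-numerator : ∀ r → _≈ᶜ_ p (imbalanceSum p F) (ι p r) → r ≡ pᵢ^ m * collisions - pᵢ^ n * pᵢ^ n
  imbalance-numerator r sum≈r = ℤ.*-cancelˡ-≡ (+ p - 1ℤ) r _ {{ℤ.>-nonZero (ℤ.positive⁻¹ _ {{+q-1-positive 1<p}})}} (begin
    (+ p - 1ℤ) * r                                         ≡⟨ trace-ι r ⟨
    trace (ι p r)                                          ≡⟨ trace-resp-≈ᶜ sum≈r ⟨
    trace (imbalanceSum p F)                               ≡⟨ trace-imbalanceSum ⟩
    (+ p - 1ℤ) * (pᵢ^ m * collisions - pᵢ^ n * pᵢ^ n)      ∎)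
    where
    open ≡-Reasoning
    1<p : 1 ℕ.< p
    1<p = ℕ.nonTrivial⇒n>1 p {{prime⇒nonTrivial p-prime}}

  missed-value⇒numerator-bound : ∀ r → _≈ᶜ_ p (imbalanceSum p F) (ι p r) →
                                 ∀ y₀ → (∀ x → F x ≢ y₀) → 1 ℕ.< p ℕ.^ m →
                                 pᵢ^ n * pᵢ^ n ≤ r * (pᵢ^ m - 1ℤ)
  missed-value⇒numerator-bound r sum≈r y₀ missed 1<pᵐ = ℤ.0≤i-j⇒j≤i (subst (0ℤ ≤_) (sym identity)
    (subst (_≤ pᵢ^ m * ((pᵢ^ m - 1ℤ) * collisions - pᵢ^ n * pᵢ^ n)) (ℤ.*-zeroʳ (pᵢ^ m))
      (ℤ.*-monoˡ-≤-nonNeg (pᵢ^ m) (ℤ.i≤j⇒0≤j-i (missed-value⇒collisions-bound y₀ missed 1<pᵐ)))))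
    where
    factor : ∀ M C P → (M * C - P * P) * (M - 1ℤ) - P * P ≡ M * ((M - 1ℤ) * C - P * P)
    factor = solve-∀
    identity : r * (pᵢ^ m - 1ℤ) - pᵢ^ n * pᵢ^ n ≡ pᵢ^ m * ((pᵢ^ m - 1ℤ) * collisions - pᵢ^ n * pᵢ^ n)
    identity = trans (cong (λ r → r * (pᵢ^ m - 1ℤ) - pᵢ^ n * pᵢ^ n) (imbalance-numerator r sum≈r))
                     (factor (pᵢ^ m) collisions (pᵢ^ n))

open import Data.Nat using (ℕ; NonZero; _^_; _*_)
open import Data.Nat.Properties using (m^n≢0)
open import Data.Nat.Primality using (Prime)
open import Data.Integer using (+_)
open import Data.Rational using (ℚ; _<_; _-_; 1ℚ) renaming (_*_ to _*ℚ_; _/_ to _/ℚ_)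

theorem4p4 : (p : ℕ) .{{_ : NonZero p}} → Prime p → (n m : ℕ)
    → (F : Fpⁿ p n → Fpⁿ p m) → (N : ℚ) → ImbalanceIs p F N
    → N *ℚ (1ℚ - (+ 1 /ℚ (p ^ m)) {{m^n≢0 p m}}) < (+ (p ^ (2 * n)) /ℚ (p ^ (2 * m))) {{m^n≢0 p (2 * m)}}
    → Surjective F
theorem4p4 p p-prime n zero F _ _ _ [] with F (zeroVec p n) in eq
... | [] = zeroVec p n , eq
theorem4p4 p p-prime n m@(suc _) F _ (r , sum≈r , refl) hyp y with any?ᵥ n (λ x → F x ≟ᵥ y)
... | yes hit   = hit
... | no missed = ⊥-elim (ℤ.<⇒≱ r[pᵐ-1]<p²ⁿ p²ⁿ≤r[pᵐ-1])
  where
  open Imbalance p p-prime F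
  r[pᵐ-1]<p²ⁿ : r ℤ.* (+ (p ^ m) ℤ.- 1ℤ) ℤ.< + (p ^ n) ℤ.* + (p ^ n)
  r[pᵐ-1]<p²ⁿ = subst (r ℤ.* (+ (p ^ m) ℤ.- 1ℤ) ℤ.<_) (trans (cong +_ (^-double p n)) (ℤ.pos-* (p ^ n) (p ^ n)))
                  (r/M*[1-1/M]<B/M²⇒r*[M-1]<B (p ^ m) {{m^n≢0 p m}} (p ^ (2 * m)) {{m^n≢0 p (2 * m)}} (^-double p m) r _ hyp)
  p²ⁿ≤r[pᵐ-1] : + (p ^ n) ℤ.* + (p ^ n) ℤ.≤ r ℤ.* (+ (p ^ m) ℤ.- 1ℤ)
  p²ⁿ≤r[pᵐ-1] = missed-value⇒numerator-bound r sum≈r y (λ x Fx≡y → missed (x , Fx≡y))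
                  (ℕ.^-monoʳ-< p (ℕ.nonTrivial⇒n>1 p {{prime⇒nonTrivial p-prime}}) {0} {m} ℕ.z<s)
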